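{- Let $G=(V,E)$ be a graph satisfying the standing assumptions, and let $u\in V$ with $\tau(u)\neq1$. Then $\tau(u)=2$ if and only if there exist $k\ge2$ and $z_1,\dots,z_k\in V$ such that (i) $(z_{i+1},z_i)\in E$ for every $1\le i\le k-1$, (ii) $z_1=u$, (iii) $z_k=z_j$ for some $1\le j\le k-1$, and (iv) $\lambda(z_1)=\lambda(z_2)=\dots=\lambda(z_k)$. Moreover, any such $z_1,\dots,z_k$ satisfy $\tau(z_i)=2$ for every $1\le i\le k$.
   Context: Standing assumptions: $\Sigma$ is a finite alphabet with a total order $\preceq$; $G=(V,E)$ is finite, $E\subseteq V\times V\times\Sigma$, every node has an incoming edge, all edges entering a node $u$ have the same label $\lambda(u)$ (edges are written $(u,v)$), and $G$ is deterministic. An occurrence of $\alpha\in\Sigma^\omega$ starting at $u$ is a sequence $(u_i)_{i\ge1}$ with $u_1=u$, $(u_{i+1},u_i)\in E$, $\lambda(u_i)=\alpha[i]$; $\min_u$ is the lexicographically smallest string in $\Sigma^\omega$ with an occurrence starting at $u$. For $\alpha=a\alpha'$ ($a\in\Sigma$): $\tau(\alpha)=1$ if $\alpha'\prec\alpha$, $2$ if $\alpha'=\alpha$, $3$ if $\alpha\prec\alpha'$; $\tau(u):=\tau(\min_u)$. -}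

module Defs where

open import Data.Nat using (ℕ; zero; suc; _<_; _≤_; _∸_)
open import Data.Fin using (Fin)
import Data.Fin as F
open import Data.Product using (Σ; ∃; _×_; _,_)
open import Relation.Binary.PropositionalEquality using (_≡_)
open import Relation.Nullary using (¬_)
open import Data.Empty using (⊥)
open import Data.Sum using (_⊎_)
open import Function.Bundles using (_⇔_)

-- The alphabet Σ is modelled as Fin s with its standard total order
-- (any finite totally ordered set is order-isomorphic to some Fin s).
-- Infinite strings in Σ^ω are functions ℕ → Fin s (0-indexed: α 0 = α[1]).
Str : ℕ → Set
Str s = ℕ → Fin s

tail : ∀ {s} → Str s → Str s
tail α i = α (suc i)

_≈ω_ : ∀ {s} → Str s → Str s → Set
α ≈ω β = ∀ i → α i ≡ β i

_≺_ : ∀ {s} → Str s → Str s → Set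
α ≺ β = ∃ λ n → (∀ i → i < n → α i ≡ β i) × (α n F.< β n)

_⪯_ : ∀ {s} → Str s → Str s → Set
α ⪯ β = α ≺ β ⊎ α ≈ω β

-- Since all edges entering a node v carry the same label
-- λ(v), an edge is determined by its endpoints: E u v means (u,v) ∈ E
-- (with label lab v).
record Graph (n s : ℕ) : Set₁ where
  field
    E   : Fin n → Fin n → Set
    lab : Fin n → Fin s
    incoming : ∀ v → ∃ λ u → E u v
    deterministic : ∀ u v w → E u v → E u w → lab v ≡ lab w → v ≡ w

module _ {n s : ℕ} (G : Graph n s) where
  open Graph G

  Occurrence : Fin n → Str s → Set
  Occurrence u α = Σ (ℕ → Fin n) λ w →
    (w 0 ≡ u) × (∀ i → E (w (suc i)) (w i)) × (∀ i → lab (w i) ≡ α i)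

  IsMin : Fin n → Str s → Set
  IsMin u α = Occurrence u α × (∀ β → Occurrence u β → α ⪯ β)

TauIs : ∀ {s} → Str s → ℕ → Set
TauIs α 1 = tail α ≺ α
TauIs α 2 = tail α ≈ω α
TauIs α 3 = α ≺ tail α
TauIs α _ = ⊥

module _ {n s : ℕ} (G : Graph n s) where
  open Graph G

  -- z_1,…,z_k (stored as z 0,…,z (k-1)) satisfying (i)–(iv) with z_1 = u
  IsChain : Fin n → (k : ℕ) → (ℕ → Fin n) → Set
  IsChain u k z =
    (2 ≤ k)
    × (∀ i → suc i < k → E (z (suc i)) (z i))
    × (z 0 ≡ u)
    × (∃ λ j → j < k ∸ 1 × z (k ∸ 1) ≡ z j)
    × (∀ i → i < k → lab (z i) ≡ lab (z 0))

{-# OPTIONS --safe #-}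
module Submission where

-- If τ(min_u) ≠ 1 and min_u starts with a, then min_u ⪯ a^ω forces min_u = a^ω as soon
-- as a^ω occurs at u; conversely a constant string occurring at u is read along a walk
-- that, by pigeonhole, repeats a node, which gives the chain.  A chain closes into a
-- loop of a-labelled nodes, so a^ω occurs at every chain node z_i.  If min_{z_i} were
-- strictly below a^ω, prefixing it with the i letters a read along z_1 … z_i would give
-- a string occurring at u strictly below a^ω = min_u.

open import Defs
open import Data.Nat using (ℕ; zero; suc; _<_; _≤_; _∸_; z≤n; s≤s; _<?_)
import Data.Nat.Properties as ℕ
open import Data.Fin using (Fin; toℕ)
import Data.Fin as F
import Data.Fin.Properties as FP
open import Data.Product using (∃; ∃₂; _×_; _,_; proj₁; proj₂)
open import Data.Sum using (inj₁; inj₂)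
open import Data.Empty using (⊥-elim)
open import Relation.Nullary using (¬_; yes; no)
open import Relation.Binary.PropositionalEquality using (_≡_; refl; sym; trans; cong; subst)
open import Relation.Binary.Definitions using (tri<; tri≈; tri>)
open import Function.Bundles using (_⇔_; mk⇔)

private
  variable
    s : ℕ
    c : Fin s
    α β γ : Str s

<∸1⇒suc< : ∀ {j k} → j < k ∸ 1 → suc j < k
<∸1⇒suc< {k = suc k} j<k = s≤s j<k

const : Fin s → Str s
const c _ = c

cons : Fin s → Str s → Str s
cons c β zero    = c
cons c β (suc t) = β t

replicate++ : ℕ → Fin s → Str s → Str s
replicate++ zero    c β = β
replicate++ (suc i) c β = replicate++ i c (cons c β)

≺-respʳ-≈ω : α ≺ β → β ≈ω γ → α ≺ γ
≺-respʳ-≈ω {α = α} (n , agree , αₙ<βₙ) β≈γ =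
  n , (λ i i<n → trans (agree i i<n) (β≈γ i)) , subst (α n F.<_) (β≈γ n) αₙ<βₙ

≺-asym : α ≺ β → ¬ β ≺ α
≺-asym (m , agreeₘ , αₘ<βₘ) (n , agreeₙ , βₙ<αₙ) with ℕ.<-cmp m n
... | tri< m<n _ _ = FP.<-irrefl (sym (agreeₙ m m<n)) αₘ<βₘ
... | tri≈ _ refl _ = FP.<-asym αₘ<βₘ βₙ<αₙ
... | tri> _ _ n<m = FP.<-irrefl (sym (agreeₘ n n<m)) βₙ<αₙ

≺⇒⋡ : α ≺ β → ¬ β ⪯ α
≺⇒⋡ α≺β (inj₁ β≺α) = ≺-asym α≺β β≺α
≺⇒⋡ (n , _ , αₙ<βₙ) (inj₂ β≈α) = FP.<-irrefl (sym (β≈α n)) αₙ<βₙ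

cons-mono-≺ : α ≺ β → cons c α ≺ cons c β
cons-mono-≺ (n , agree , αₙ<βₙ) = suc n , agree′ , αₙ<βₙ
  where
  agree′ : ∀ i → i < suc n → cons _ _ i ≡ cons _ _ i
  agree′ zero    _         = refl
  agree′ (suc i) (s≤s i<n) = agree i i<n

replicate++-mono-≺ : ∀ i → α ≺ β → replicate++ i c α ≺ replicate++ i c β
replicate++-mono-≺ zero    α≺β = α≺β
replicate++-mono-≺ (suc i) α≺β = replicate++-mono-≺ i (cons-mono-≺ α≺β)

cons-const : β ≈ω const c → cons c β ≈ω const c
cons-const β≈c zero    = refl
cons-const β≈c (suc t) = β≈c t

replicate++-const : ∀ i → β ≈ω const c → replicate++ i c β ≈ω const c
replicate++-const zero    β≈c = β≈c
replicate++-const (suc i) β≈c = replicate++-const i (cons-const β≈c)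

tail-≈ω⇒≈ω-const : tail α ≈ω α → α ≈ω const (α 0)
tail-≈ω⇒≈ω-const tα≈α zero    = refl
tail-≈ω⇒≈ω-const tα≈α (suc t) = trans (tα≈α t) (tail-≈ω⇒≈ω-const tα≈α t)

≈ω-const⇒τ₂ : α ≈ω const c → TauIs α 2
≈ω-const⇒τ₂ α≈c t = trans (α≈c (suc t)) (sym (α≈c t))

-- A first deviation of α from c^ω at position m + 1 makes tail α deviate downwards at m.
⪯-const⇒≈ω-const : α ⪯ const c → α 0 ≡ c → ¬ TauIs α 1 → α ≈ω const c
⪯-const⇒≈ω-const (inj₂ α≈c) _ _ = α≈c
⪯-const⇒≈ω-const (inj₁ (zero , _ , α₀<c)) α₀≡c _ = ⊥-elim (FP.<-irrefl α₀≡c α₀<c)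
⪯-const⇒≈ω-const {α = α} (inj₁ (suc m , agree , α₁₊ₘ<c)) _ ¬τ₁ =
  ⊥-elim (¬τ₁ (m , agree′ , subst (α (suc m) F.<_) (sym (agree m (ℕ.n<1+n m))) α₁₊ₘ<c))
  where
  agree′ : ∀ i → i < m → α (suc i) ≡ α i
  agree′ i i<m = trans (agree (suc i) (s≤s i<m)) (sym (agree i (ℕ.m<n⇒m<1+n i<m)))

module _ {n : ℕ} (G : Graph n s) where
  open Graph G

  occurrence-head : ∀ {u} → Occurrence G u α → α 0 ≡ lab u
  occurrence-head (w , w₀≡u , _ , labels) = trans (sym (labels 0)) (cong lab w₀≡u)

  cons-occurrence : ∀ {x y} → E y x → Occurrence G y β → Occurrence G x (cons (lab x) β)
  cons-occurrence {x = x} e (w , w₀≡y , edges , labels) = w′ , refl , edges′ , labels′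
    where
    w′ : ℕ → Fin n
    w′ zero    = x
    w′ (suc t) = w t
    edges′ : ∀ i → E (w′ (suc i)) (w′ i)
    edges′ zero    = subst (λ y → E y x) (sym w₀≡y) e
    edges′ (suc i) = edges i
    labels′ : ∀ i → lab (w′ i) ≡ cons (lab x) _ i
    labels′ zero    = refl
    labels′ (suc i) = labels i

  constant-occurrence⇒chain : ∀ {u} → Occurrence G u α → tail α ≈ω α → ∃₂ (IsChain G u)
  constant-occurrence⇒chain {α = α} (w , w₀≡u , edges , labels) tα≈α
    with FP.pigeonhole (ℕ.n<1+n n) (λ i → w (toℕ i))
  ... | i , j , i<j , wᵢ≡wⱼ =
    suc (toℕ j) , w , s≤s (ℕ.<-≤-trans (s≤s z≤n) i<j) , (λ t _ → edges t) , w₀≡u ,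
    (toℕ i , i<j , sym wᵢ≡wⱼ) , (λ t _ → trans (labels t) (trans (α≈α₀ t) (sym (labels 0))))
    where
    α≈α₀ : α ≈ω const (α 0)
    α≈α₀ = tail-≈ω⇒≈ω-const tα≈α

  module Chain {u k z} (chain : IsChain G u k z) where
    a : Fin s
    a = lab (z 0)

    z₀≡u : z 0 ≡ u
    z₀≡u = let (_ , _ , p , _) = chain in p

    private
      2≤k : 2 ≤ k
      2≤k = let (p , _) = chain in p
      edge : ∀ i → suc i < k → E (z (suc i)) (z i)
      edge = let (_ , p , _) = chain in p
      loop : ∃ λ j → j < k ∸ 1 × z (k ∸ 1) ≡ z j
      loop = let (_ , _ , _ , p , _) = chain in p
      label : ∀ i → i < k → lab (z i) ≡ a
      label = let (_ , _ , _ , _ , p) = chain in p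

    0<k : 0 < k
    0<k = ℕ.<-≤-trans (s≤s z≤n) 2≤k

    -- The successor along the loop z_1 → … → z_k = z_j → z_{j+1} → …
    next : ℕ → ℕ
    next m with suc m <? k
    ... | yes _ = suc m
    ... | no _  = let (j , _) = loop in suc j

    next<k : ∀ m → next m < k
    next<k m with suc m <? k
    ... | yes m+1<k = m+1<k
    ... | no _      = let (_ , j<k-1 , _) = loop in <∸1⇒suc< j<k-1

    next-edge : ∀ m → m < k → E (z (next m)) (z m)
    next-edge m m<k with suc m <? k
    ... | yes m+1<k = edge m m+1<k
    ... | no m+1≮k  = let (j , j<k-1 , zₖ≡zⱼ) = loop in
      subst (E (z (suc j))) (trans (sym zₖ≡zⱼ) (cong z k-1≡m)) (edge j (<∸1⇒suc< j<k-1))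
      where
      k-1≡m : k ∸ 1 ≡ m
      k-1≡m = cong (_∸ 1) (sym (ℕ.≤-antisym m<k (ℕ.≮⇒≥ m+1≮k)))

    cycle-occurrence : ∀ i → i < k → Occurrence G (z i) (const a)
    cycle-occurrence i i<k = (λ t → z (walk t)) , refl , (λ t → next-edge (walk t) (walk<k t))
                           , (λ t → label (walk t) (walk<k t))
      where
      walk : ℕ → ℕ
      walk zero    = i
      walk (suc t) = next (walk t)
      walk<k : ∀ t → walk t < k
      walk<k zero    = i<k
      walk<k (suc t) = next<k (walk t)

    prefix-occurrence : ∀ i → i < k → Occurrence G (z i) β → Occurrence G u (replicate++ i a β)
    prefix-occurrence zero    _   occ = subst (λ v → Occurrence G v _) z₀≡u occ
    prefix-occurrence (suc i) i<k occ =
      prefix-occurrence i (ℕ.<⇒≤ i<k)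
        (subst (λ b → Occurrence G (z i) (cons b _)) (label i (ℕ.<⇒≤ i<k))
          (cons-occurrence (edge i i<k) occ))

  module _ {u k z} (chain : IsChain G u k z) (min : IsMin G u α) (¬τ₁ : ¬ TauIs α 1) where
    open Chain chain

    chain-min≈ω-const : α ≈ω const a
    chain-min≈ω-const =
      ⪯-const⇒≈ω-const (proj₂ min _ (subst (λ v → Occurrence G v _) z₀≡u (cycle-occurrence 0 0<k)))
                       (trans (occurrence-head (proj₁ min)) (cong lab (sym z₀≡u))) ¬τ₁

    chain-node-min≈ω-const : ∀ {i} → i < k → IsMin G (z i) β → β ≈ω const a
    chain-node-min≈ω-const {β = β} {i = i} i<k (occβ , belowβ) with belowβ _ (cycle-occurrence i i<k)
    ... | inj₂ β≈a = β≈a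
    ... | inj₁ β≺a = ⊥-elim (≺⇒⋡ prefixed≺α (proj₂ min _ (prefix-occurrence i i<k occβ)))
      where
      prefixed≺α : replicate++ i a β ≺ α
      prefixed≺α = ≺-respʳ-≈ω (replicate++-mono-≺ i β≺a)
        (λ t → trans (replicate++-const i (λ _ → refl) t) (sym (chain-min≈ω-const t)))

lemma9 : ∀ {n s} (G : Graph n s) (u : Fin n) (α : Str s) → IsMin G u α → ¬ TauIs α 1 →
    (TauIs α 2 ⇔ ∃₂ (λ k z → IsChain G u k z))
    × (∀ k z → IsChain G u k z → ∀ i → i < k → ∀ β → IsMin G (z i) β → TauIs β 2)
lemma9 G u α min@(occ , _) ¬τ₁ =
  mk⇔ (constant-occurrence⇒chain G occ) (λ (_ , _ , chain) → ≈ω-const⇒τ₂ (chain-min≈ω-const G chain min ¬τ₁))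
  , chain-τ₂
  where
  chain-τ₂ : ∀ k z → IsChain G u k z → ∀ i → i < k → ∀ β → IsMin G (z i) β → TauIs β 2
  chain-τ₂ k z chain i i<k β minβ = ≈ω-const⇒τ₂ (chain-node-min≈ω-const G chain min ¬τ₁ i<k minβ)
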